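{- Let $G$ be a finite abelian group and let $A$ be a subset of $G\setminus\{0\}$ with $|A|=\mathrm{cr}(G)-1$ and $\sum(A)\neq G$. If $A'$ is a complete subset of $A$, then $A\cap\langle A'\rangle=\langle A'\rangle\setminus\{0\}$.
   Context: For a subset $A$ of $G$, $\sum(A)=\{\sum_{g\in B}g:\emptyset\neq B\subseteq A\}$ and $\langle A\rangle$ is the subgroup generated by $A$. A nonempty set $A$ is complete if $\sum(A)=\langle A\rangle$. The critical number $\mathrm{cr}(G)$ is the least positive integer $\ell$ such that every subset $A\subseteq G\setminus\{0\}$ with $|A|\geq\ell$ satisfies $\sum(A)=G$. -}

module Defs where

open import Level using (0ℓ) renaming (suc to lsuc)
open import Data.Nat using (ℕ; zero; suc; _<_; _∸_)
open import Data.Fin using (Fin; zero; suc)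
open import Data.Fin.Subset using (Subset; _∈_; _⊆_; Nonempty; ∣_∣)
open import Data.Vec using ([]; _∷_)
open import Data.Bool using (true; false)
open import Data.Product using (Σ; ∃; ∃-syntax; _×_)
open import Relation.Nullary using (¬_)
open import Relation.Binary.PropositionalEquality using (_≡_)
open import Algebra.Bundles using (AbelianGroup)

record FiniteAbelianGroup : Set₁ where
  field
    grp   : AbelianGroup 0ℓ 0ℓ
  open AbelianGroup grp public
  field
    size  : ℕ
    enum  : Fin size → Carrier
    enum-inj  : ∀ {i j} → enum i ≈ enum j → i ≡ j
    enum-surj : ∀ x → ∃[ i ] (enum i ≈ x)

module _ (G : FiniteAbelianGroup) where
  open FiniteAbelianGroup G

  -- subsets of G are subsets of the index set Fin size (via enum)

  _∈G_ : Carrier → Subset size → Set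
  x ∈G A = ∃[ i ] (i ∈ A × enum i ≈ x)

  sumOver : ∀ {m} → (Fin m → Carrier) → Subset m → Carrier
  sumOver f []          = ε
  sumOver f (true ∷ p)  = f zero ∙ sumOver (λ i → f (suc i)) p
  sumOver f (false ∷ p) = sumOver (λ i → f (suc i)) p

  subsetSum : Subset size → Carrier
  subsetSum = sumOver enum

  _∈Σ_ : Carrier → Subset size → Set
  x ∈Σ A = ∃[ B ] (B ⊆ A × Nonempty B × subsetSum B ≈ x)

  record IsSubgroup (H : Carrier → Set) : Set where
    field
      resp  : ∀ {x y} → x ≈ y → H x → H y
      has-ε : H ε
      ∙-closed : ∀ {x y} → H x → H y → H (x ∙ y)
      ⁻¹-closed : ∀ {x} → H x → H (x ⁻¹)

  _∈⟨_⟩ : Carrier → Subset size → Set₁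
  x ∈⟨ A ⟩ = (H : Carrier → Set) → IsSubgroup H → (∀ y → y ∈G A → H y) → H x

  AvoidsZero : Subset size → Set
  AvoidsZero A = ∀ x → x ∈G A → ¬ (x ≈ ε)

  SumsetIsG : Subset size → Set
  SumsetIsG A = ∀ x → x ∈Σ A

  Complete : Subset size → Set₁
  Complete A = Nonempty A × (∀ x → (x ∈Σ A → x ∈⟨ A ⟩) × (x ∈⟨ A ⟩ → x ∈Σ A))

  CritProp : ℕ → Set
  CritProp ℓ = ∀ (A : Subset size) → AvoidsZero A → ℓ Data.Nat.≤ ∣ A ∣ → SumsetIsG A

  IsCriticalNumber : ℕ → Set
  IsCriticalNumber ℓ = 0 < ℓ × CritProp ℓ × (∀ k → 0 < k → k < ℓ → ¬ CritProp k)

module Submission where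

-- The inclusion A ∩ ⟨A′⟩ ⊆ ⟨A′⟩ ∖ {0} is immediate since 0 ∉ A.
-- For the converse, take x ∈ ⟨A′⟩ ∖ {0} and suppose x ∉ A.  Then A ∪ {x}
-- avoids 0 and has cr(G) elements, so Σ(A ∪ {x}) = G.  The heart of the
-- proof is the absorption lemma: for a complete A′, every z ∈ ⟨A′⟩ and any
-- B, the element z + ΣB is a subset sum of A′ ∪ B (split B along A′ and
-- rewrite z + Σ(B ∩ A′) ∈ ⟨A′⟩ = Σ(A′) as a sum over some C ⊆ A′).
-- Consequently adjoining an element of ⟨A′⟩ to a superset of A′ creates no
-- new subset sums, so Σ(A) = Σ(A ∪ {x}) = G, a contradiction.

open import Defs
open import Data.Nat using (ℕ; _∸_; zero; suc; _≤_; _<_)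
open import Data.Fin using (Fin; zero; suc)
open import Data.Fin.Subset using (Subset; _∈_; _∉_; _⊆_; _∪_; _∩_; _─_; ⁅_⁆; ∣_∣)
open import Data.Fin.Subset.Properties
  using (_∈?_; x∈p∪q⁻; x∈p∩q⁻; x∈⁅x⁆; x∈⁅y⁆⇒x≡y; p⊆p∪q; q⊆p∪q; p─q⊆p; p⊂q⇒∣p∣<∣q∣)
open import Data.Vec using (_∷_; []; here; there)
open import Data.Bool using (true; false)
open import Data.Product using (_×_; _,_; proj₂)
open import Data.Sum using (inj₁; inj₂)
open import Data.Empty using (⊥-elim)
open import Relation.Nullary using (¬_; yes; no)
open import Relation.Binary.PropositionalEquality as ≡ using (_≡_)
open import Function using (_∘_)
import Algebra.Properties.CommutativeSemigroup as CommSemigroupProperties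

Disjoint : ∀ {m} → Subset m → Subset m → Set
Disjoint p q = ∀ {i} → i ∈ p → i ∉ q

Disjoint-tail : ∀ {m s t} {p q : Subset m} → Disjoint (s ∷ p) (t ∷ q) → Disjoint p q
Disjoint-tail disj i∈p i∈q = disj (there i∈p) (there i∈q)

x∈p─q⇒x∉q : ∀ {m} {i : Fin m} (p q : Subset m) → i ∈ p ─ q → i ∉ q
x∈p─q⇒x∉q (_ ∷ p) (true ∷ q)  (there i∈p─q) (there i∈q) = x∈p─q⇒x∉q p q i∈p─q i∈q
x∈p─q⇒x∉q (_ ∷ p) (false ∷ q) (there i∈p─q) (there i∈q) = x∈p─q⇒x∉q p q i∈p─q i∈q

∪-least : ∀ {m} {p q r : Subset m} → p ⊆ r → q ⊆ r → p ∪ q ⊆ r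
∪-least {p = p} {q} p⊆r q⊆r i∈p∪q with x∈p∪q⁻ p q i∈p∪q
... | inj₁ i∈p = p⊆r i∈p
... | inj₂ i∈q = q⊆r i∈q

─-⊆ : ∀ {m} {p q r : Subset m} → p ⊆ q ∪ r → p ─ r ⊆ q
─-⊆ {p = p} {q} {r} p⊆q∪r i∈p─r with x∈p∪q⁻ q r (p⊆q∪r (p─q⊆p p r i∈p─r))
... | inj₁ i∈q = i∈q
... | inj₂ i∈r = ⊥-elim (x∈p─q⇒x∉q p r i∈p─r i∈r)

insert-card : ∀ {m} {j : Fin m} {A : Subset m} → j ∉ A → ∣ A ∣ < ∣ A ∪ ⁅ j ⁆ ∣
insert-card {j = j} {A} j∉A = p⊂q⇒∣p∣<∣q∣ (p⊆p∪q ⁅ j ⁆ , j , q⊆p∪q A ⁅ j ⁆ (x∈⁅x⁆ j) , j∉A)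

module InGroup (G : FiniteAbelianGroup) where
  open FiniteAbelianGroup G
  open CommSemigroupProperties commutativeSemigroup using (x∙yz≈y∙xz)
  open import Relation.Binary.Reasoning.Setoid setoid

  sum : ∀ {m} → (Fin m → Carrier) → Subset m → Carrier
  sum = sumOver G

  sum-∪ : ∀ {m} (f : Fin m → Carrier) (p q : Subset m) → Disjoint p q →
          sum f (p ∪ q) ≈ sum f p ∙ sum f q
  sum-∪ f [] [] _ = sym (identityʳ ε)
  sum-∪ f (true ∷ p) (true ∷ q) disj = ⊥-elim (disj here here)
  sum-∪ f (true ∷ p) (false ∷ q) disj = begin
    f zero ∙ sum (f ∘ suc) (p ∪ q)               ≈⟨ ∙-congˡ (sum-∪ (f ∘ suc) p q (Disjoint-tail disj)) ⟩
    f zero ∙ (sum (f ∘ suc) p ∙ sum (f ∘ suc) q) ≈⟨ sym (assoc _ _ _) ⟩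
    (f zero ∙ sum (f ∘ suc) p) ∙ sum (f ∘ suc) q ∎
  sum-∪ f (false ∷ p) (true ∷ q) disj = begin
    f zero ∙ sum (f ∘ suc) (p ∪ q)               ≈⟨ ∙-congˡ (sum-∪ (f ∘ suc) p q (Disjoint-tail disj)) ⟩
    f zero ∙ (sum (f ∘ suc) p ∙ sum (f ∘ suc) q) ≈⟨ x∙yz≈y∙xz _ _ _ ⟩
    sum (f ∘ suc) p ∙ (f zero ∙ sum (f ∘ suc) q) ∎
  sum-∪ f (false ∷ p) (false ∷ q) disj = sum-∪ (f ∘ suc) p q (Disjoint-tail disj)

  sum-split : ∀ {m} (f : Fin m → Carrier) (p q : Subset m) →
              sum f p ≈ sum f (p ∩ q) ∙ sum f (p ─ q)
  sum-split f [] [] = sym (identityʳ ε)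
  sum-split f (true ∷ p) (true ∷ q) = begin
    f zero ∙ sum (f ∘ suc) p                                 ≈⟨ ∙-congˡ (sum-split (f ∘ suc) p q) ⟩
    f zero ∙ (sum (f ∘ suc) (p ∩ q) ∙ sum (f ∘ suc) (p ─ q)) ≈⟨ sym (assoc _ _ _) ⟩
    (f zero ∙ sum (f ∘ suc) (p ∩ q)) ∙ sum (f ∘ suc) (p ─ q) ∎
  sum-split f (true ∷ p) (false ∷ q) = begin
    f zero ∙ sum (f ∘ suc) p                                 ≈⟨ ∙-congˡ (sum-split (f ∘ suc) p q) ⟩
    f zero ∙ (sum (f ∘ suc) (p ∩ q) ∙ sum (f ∘ suc) (p ─ q)) ≈⟨ x∙yz≈y∙xz _ _ _ ⟩
    sum (f ∘ suc) (p ∩ q) ∙ (f zero ∙ sum (f ∘ suc) (p ─ q)) ∎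
  sum-split f (false ∷ p) (true ∷ q) = sum-split (f ∘ suc) p q
  sum-split f (false ∷ p) (false ∷ q) = sum-split (f ∘ suc) p q

  sum-closed : (H : Carrier → Set) → IsSubgroup G H → ∀ {m} (f : Fin m → Carrier) (p : Subset m) →
               (∀ {i} → i ∈ p → H (f i)) → H (sum f p)
  sum-closed H H-sub f [] _ = IsSubgroup.has-ε H-sub
  sum-closed H H-sub f (true ∷ p) summands =
    IsSubgroup.∙-closed H-sub (summands here) (sum-closed H H-sub (f ∘ suc) p (summands ∘ there))
  sum-closed H H-sub f (false ∷ p) summands = sum-closed H H-sub (f ∘ suc) p (summands ∘ there)

  _∈⟨_⟩ᴳ : Carrier → Subset size → Set₁
  x ∈⟨ A ⟩ᴳ = _∈⟨_⟩ G x A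

  _∈Σᴳ_ : Carrier → Subset size → Set
  x ∈Σᴳ A = _∈Σ_ G x A

  ⟨⟩-base : ∀ {A i} → i ∈ A → enum i ∈⟨ A ⟩ᴳ
  ⟨⟩-base {i = i} i∈A H _ A⊆H = A⊆H (enum i) (i , i∈A , refl)

  ⟨⟩-resp : ∀ {A x y} → x ≈ y → x ∈⟨ A ⟩ᴳ → y ∈⟨ A ⟩ᴳ
  ⟨⟩-resp x≈y x∈⟨A⟩ H H-sub A⊆H = IsSubgroup.resp H-sub x≈y (x∈⟨A⟩ H H-sub A⊆H)

  ⟨⟩-∙ : ∀ {A x y} → x ∈⟨ A ⟩ᴳ → y ∈⟨ A ⟩ᴳ → (x ∙ y) ∈⟨ A ⟩ᴳ
  ⟨⟩-∙ x∈⟨A⟩ y∈⟨A⟩ H H-sub A⊆H = IsSubgroup.∙-closed H-sub (x∈⟨A⟩ H H-sub A⊆H) (y∈⟨A⟩ H H-sub A⊆H)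

  ⟨⟩-sum : ∀ {A} (P : Subset size) → (∀ {i} → i ∈ P → enum i ∈⟨ A ⟩ᴳ) → sum enum P ∈⟨ A ⟩ᴳ
  ⟨⟩-sum P summands H H-sub A⊆H = sum-closed H H-sub enum P (λ i∈P → summands i∈P H H-sub A⊆H)

  ∈Σ-resp : ∀ {A x y} → x ≈ y → x ∈Σᴳ A → y ∈Σᴳ A
  ∈Σ-resp x≈y (B , B⊆A , B≠∅ , sumB≈x) = B , B⊆A , B≠∅ , trans sumB≈x x≈y

  ∈Σ-mono : ∀ {A A₂ x} → A ⊆ A₂ → x ∈Σᴳ A → x ∈Σᴳ A₂
  ∈Σ-mono A⊆A₂ (B , B⊆A , B≠∅ , sumB≈x) = B , A⊆A₂ ∘ B⊆A , B≠∅ , sumB≈x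

  -- Write ΣB = Σ(B ∩ A′) + Σ(B ∖ A′); then z + Σ(B ∩ A′) ∈ ⟨A′⟩ = Σ(A′)
  -- is ΣC for a nonempty C ⊆ A′, and C ∪ (B ∖ A′) is the required subset.
  absorb : ∀ {A′} → Complete G A′ → ∀ {z} → z ∈⟨ A′ ⟩ᴳ → (B : Subset size) →
           (z ∙ sum enum B) ∈Σᴳ (A′ ∪ B)
  absorb {A′} (_ , complete) {z} z∈⟨A′⟩ B = rebuild (proj₂ (complete _) w∈⟨A′⟩)
    where
    w∈⟨A′⟩ : (z ∙ sum enum (B ∩ A′)) ∈⟨ A′ ⟩ᴳ
    w∈⟨A′⟩ = ⟨⟩-∙ z∈⟨A′⟩ (⟨⟩-sum (B ∩ A′) (λ i∈B∩A′ → ⟨⟩-base (proj₂ (x∈p∩q⁻ B A′ i∈B∩A′))))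

    rebuild : (z ∙ sum enum (B ∩ A′)) ∈Σᴳ A′ → (z ∙ sum enum B) ∈Σᴳ (A′ ∪ B)
    rebuild (C , C⊆A′ , (i , i∈C) , sumC) =
      C ∪ (B ─ A′) ,
      ∪-least (p⊆p∪q B ∘ C⊆A′) (q⊆p∪q A′ B ∘ p─q⊆p B A′) ,
      (i , p⊆p∪q (B ─ A′) i∈C) ,
      (begin
        sum enum (C ∪ (B ─ A′))                            ≈⟨ sum-∪ enum C (B ─ A′) C∩[B─A′]≡∅ ⟩
        sum enum C ∙ sum enum (B ─ A′)                     ≈⟨ ∙-congʳ sumC ⟩
        (z ∙ sum enum (B ∩ A′)) ∙ sum enum (B ─ A′)        ≈⟨ assoc _ _ _ ⟩
        z ∙ (sum enum (B ∩ A′) ∙ sum enum (B ─ A′))        ≈⟨ ∙-congˡ (sym (sum-split enum B A′)) ⟩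
        z ∙ sum enum B                                     ∎)
      where
      C∩[B─A′]≡∅ : Disjoint C (B ─ A′)
      C∩[B─A′]≡∅ i∈C i∈B─A′ = x∈p─q⇒x∉q B A′ i∈B─A′ (C⊆A′ i∈C)

  -- Adjoining an element of ⟨A′⟩ to a set A ⊇ A′ with A′ complete creates
  -- no new subset sums: split a sum over B ⊆ A ∪ {j} as the (empty or
  -- singleton) part at j, which lies in ⟨A′⟩, plus a sum over B ∖ {j} ⊆ A,
  -- and absorb the former.
  adjoin-span : ∀ {A A′ j} → Complete G A′ → A′ ⊆ A → enum j ∈⟨ A′ ⟩ᴳ →
                ∀ {y} → y ∈Σᴳ (A ∪ ⁅ j ⁆) → y ∈Σᴳ A
  adjoin-span {A} {A′} {j} A′-complete A′⊆A j∈⟨A′⟩ (B , B⊆A∪j , _ , sumB≈y) =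
    ∈Σ-mono (∪-least A′⊆A (─-⊆ B⊆A∪j))
            (∈Σ-resp (trans (sym (sum-split enum B ⁅ j ⁆)) sumB≈y)
                     (absorb A′-complete part-at-j∈⟨A′⟩ (B ─ ⁅ j ⁆)))
    where
    part-at-j∈⟨A′⟩ : sum enum (B ∩ ⁅ j ⁆) ∈⟨ A′ ⟩ᴳ
    part-at-j∈⟨A′⟩ = ⟨⟩-sum (B ∩ ⁅ j ⁆) λ i∈B∩j →
      ≡.subst (λ k → enum k ∈⟨ A′ ⟩ᴳ) (≡.sym (x∈⁅y⁆⇒x≡y j (proj₂ (x∈p∩q⁻ B ⁅ j ⁆ i∈B∩j)))) j∈⟨A′⟩

  insert-avoids : ∀ {A j} → AvoidsZero G A → ¬ (enum j ≈ ε) → AvoidsZero G (A ∪ ⁅ j ⁆)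
  insert-avoids {A} {j} A-avoids j≉ε y (i , i∈A∪j , i↦y) y≈ε with x∈p∪q⁻ A ⁅ j ⁆ i∈A∪j
  ... | inj₁ i∈A = A-avoids y (i , i∈A , i↦y) y≈ε
  ... | inj₂ i∈j rewrite x∈⁅y⁆⇒x≡y j i∈j = j≉ε (trans i↦y y≈ε)

mainTheorem4 : (G : FiniteAbelianGroup) → (ℓ : ℕ) → IsCriticalNumber G ℓ →
    (A : Subset (FiniteAbelianGroup.size G)) → AvoidsZero G A → ∣ A ∣ ≡ ℓ ∸ 1 →
    ¬ SumsetIsG G A →
    (A′ : Subset (FiniteAbelianGroup.size G)) → A′ ⊆ A → Complete G A′ →
    (x : FiniteAbelianGroup.Carrier G) →
    ((_∈G_ G x A × _∈⟨_⟩ G x A′) → (_∈⟨_⟩ G x A′ × ¬ FiniteAbelianGroup._≈_ G x (FiniteAbelianGroup.ε G)))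
    × ((_∈⟨_⟩ G x A′ × ¬ FiniteAbelianGroup._≈_ G x (FiniteAbelianGroup.ε G)) → (_∈G_ G x A × _∈⟨_⟩ G x A′))
mainTheorem4 G zero (() , _) _ _ _ _ _ _ _ _
mainTheorem4 G (suc k) (_ , cr-sums , _) A A-avoids ∣A∣≡k ΣA≢G A′ A′⊆A A′-complete x =
  (λ (x∈A , x∈⟨A′⟩) → x∈⟨A′⟩ , A-avoids x x∈A) , outside-A-impossible
  where
  open FiniteAbelianGroup G
  open InGroup G
  -- If x ∉ A, then A ∪ {x} has cr(G) nonzero elements, so Σ(A ∪ {x}) = G,
  -- and adjoining x ∈ ⟨A′⟩ added no sums, forcing Σ(A) = G.
  outside-A-impossible : x ∈⟨ A′ ⟩ᴳ × ¬ (x ≈ ε) → _∈G_ G x A × x ∈⟨ A′ ⟩ᴳ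
  outside-A-impossible (x∈⟨A′⟩ , x≉ε) with enum-surj x
  ... | j , j↦x with j ∈? A
  ...   | yes j∈A = (j , j∈A , j↦x) , x∈⟨A′⟩
  ...   | no j∉A = ⊥-elim (ΣA≢G λ y →
            adjoin-span A′-complete A′⊆A (⟨⟩-resp (sym j↦x) x∈⟨A′⟩)
              (cr-sums (A ∪ ⁅ j ⁆) (insert-avoids A-avoids (x≉ε ∘ trans (sym j↦x)))
                 (≡.subst (λ n → suc n ≤ ∣ A ∪ ⁅ j ⁆ ∣) ∣A∣≡k (insert-card j∉A)) y))
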